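{- Let $\mathcal G$ be a GBS graph of groups over the graph $Y$ and let $w=a_0^{k_0}y_1a_1^{k_1}\cdots y_na_n^{k_n}$ be a $\mathcal G$-factorization. If $w$ lies in the cyclic subgroup $\langle a_0\rangle$ of $F(\mathcal G)$, then $w=a_0^{k}$ in $F(\mathcal G)$ for $$k=\sum_{\nu=0}^{n}k_\nu\cdot\prod_{\mu=1}^{\nu}\frac{\alpha_{y_\mu}}{\beta_{y_\mu}}.$$
   Context: A GBS graph of groups $\mathcal G$ consists of a finite connected graph $Y$ in Serre's sense (vertices $V(Y)$, edges $E(Y)$, maps $\iota,\tau:E(Y)\to V(Y)$, fixed-point-free involution $y\mapsto\bar y$ with $\iota(y)=\tau(\bar y)$) and integers $\alpha_y,\beta_y\in\mathbb Z\setminus\{0\}$, $y\in E(Y)$, with $\alpha_y=\beta_{\bar y}$. $F(\mathcal G)$ is the group generated by $V(Y)\cup E(Y)$ with relations $\bar yy=1$ and $y\,b^{\beta_y}\,\bar y=a^{\alpha_y}$ for $y\in E(Y)$, $a=\iota(y)$, $b=\tau(y)$. A $\mathcal G$-factorization is a word $a_0^{k_0}y_1a_1^{k_1}\cdots y_na_n^{k_n}$ ($n\ge0$) with $y_i\in E(Y)$, $a_i\in V(Y)$, $k_i\in\mathbb Z$, $\iota(y_i)=a_{i-1}$, $\tau(y_i)=a_i$ and $a_n=a_0$. -}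

module Defs where

open import Data.Nat using (ℕ; zero; suc)
open import Data.Integer as ℤ using (ℤ; +_; -[1+_])
open import Data.Rational.Unnormalised as Q using (ℚᵘ; _≃_)
open import Data.Fin using (Fin)
open import Data.Bool using (Bool; true; false; not)
open import Data.Sum using (_⊎_; inj₁; inj₂)
open import Data.Product using (_×_; _,_)
open import Data.List using (List; []; _∷_; _++_; replicate)
open import Relation.Binary.PropositionalEquality using (_≡_; _≢_)

data Reach {nV nE : ℕ} (ι τ : Fin nE → Fin nV) : Fin nV → Fin nV → Set where
  here : ∀ {v} → Reach ι τ v v
  step : ∀ {v} (y : Fin nE) → Reach ι τ (τ y) v → Reach ι τ (ι y) v

record GBS : Set where
  field
    nV nE   : ℕ
    ι τ     : Fin nE → Fin nV
    bar     : Fin nE → Fin nE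
    bar-inv : ∀ y → bar (bar y) ≡ y
    bar-fpf : ∀ y → bar y ≢ y
    ι-bar   : ∀ y → ι y ≡ τ (bar y)
    connected : ∀ u v → Reach ι τ u v
    α β     : Fin nE → ℤ
    α≢0     : ∀ y → α y ≢ + 0
    β≢0     : ∀ y → β y ≢ + 0
    α-bar   : ∀ y → α y ≡ β (bar y)

module _ (G : GBS) where
  open GBS G

  Gen : Set
  Gen = Fin nV ⊎ Fin nE

  -- words in the free group on Gen: letters with a sign (true = g, false = g⁻¹)
  Word : Set
  Word = List (Gen × Bool)

  pow : Gen → ℤ → Word
  pow g (+ n)    = replicate n (g , true)
  pow g -[1+ n ] = replicate (suc n) (g , false)

  vpow : Fin nV → ℤ → Word
  vpow a k = pow (inj₁ a) k

  edge : Fin nE → Word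
  edge y = (inj₂ y , true) ∷ []

  data _≈_ : Word → Word → Set where
    ≈-refl  : ∀ {u} → u ≈ u
    ≈-sym   : ∀ {u v} → u ≈ v → v ≈ u
    ≈-trans : ∀ {u v w} → u ≈ v → v ≈ w → u ≈ w
    ≈-cong  : ∀ {u u′ v v′} → u ≈ u′ → v ≈ v′ → (u ++ v) ≈ (u′ ++ v′)
    cancel  : ∀ g b → ((g , b) ∷ (g , not b) ∷ []) ≈ []
    rel-bar : ∀ y → (edge (bar y) ++ edge y) ≈ []
    rel-edge : ∀ y → (edge y ++ vpow (τ y) (β y) ++ edge (bar y)) ≈ vpow (ι y) (α y)

  -- A G-factorization a₀^{k₀} y₁ a₁^{k₁} ⋯ yₙ aₙ^{kₙ} is represented by
  -- a₀, k₀ and the list of pairs (y_i , k_i) (with a_i = τ(y_i)) such that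
  -- the edge path is valid and closed at a₀.
  ValidPath : Fin nV → List (Fin nE × ℤ) → Fin nV → Set
  ValidPath a []             b = a ≡ b
  ValidPath a ((y , k) ∷ s) b = (ι y ≡ a) × ValidPath (τ y) s b

  record Factorization : Set where
    field
      a₀    : Fin nV
      k₀    : ℤ
      steps : List (Fin nE × ℤ)
      valid : ValidPath a₀ steps a₀

  stepsWord : List (Fin nE × ℤ) → Word
  stepsWord []             = []
  stepsWord ((y , k) ∷ s) = edge y ++ vpow (τ y) k ++ stepsWord s

  word : Factorization → Word
  word f = vpow (Factorization.a₀ f) (Factorization.k₀ f) ++ stepsWord (Factorization.steps f)

  -- p / q as a rational for integers p, q (q ≠ 0; value at q = 0 is junk, never used)
  divℤ : ℤ → ℤ → ℚᵘ
  divℤ p (+ zero)    = Q.0ℚᵘ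
  divℤ p (+ suc n)   = p Q./ suc n
  divℤ p -[1+ n ]    = (ℤ.- p) Q./ suc n

  -- Σ_{ν≥1} k_ν ∏_{μ=1}^{ν} α_{y_μ}/β_{y_μ}, with running product r
  stepsSum : ℚᵘ → List (Fin nE × ℤ) → ℚᵘ
  stepsSum r []             = Q.0ℚᵘ
  stepsSum r ((y , k) ∷ s) =
    let r′ = r Q.* divℤ (α y) (β y) in (k Q./ 1) Q.* r′ Q.+ stepsSum r′ s

  exponent : Factorization → ℚᵘ
  exponent f = (Factorization.k₀ f Q./ 1) Q.+ stepsSum Q.1ℚᵘ (Factorization.steps f)

module Submission where

-- F(G) acts on ℚ by affine maps: a vertex generator a acts as the
-- translation x ↦ x + 1 and an edge generator y as the dilation
-- x ↦ (α_y/β_y)·x.  The defining relations of F(G) hold for these maps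
-- (y ȳ acts trivially since α_ȳ/β_ȳ = β_y/α_y, and y b^{β_y} ȳ is the
-- translation by (α_y/β_y)·β_y = α_y, like a^{α_y}), so evaluating a word
-- at 0 is an invariant of its class in F(G).  Evaluating the factorization
-- w = a₀^{k₀} y₁ a₁^{k₁} ⋯ yₙ aₙ^{kₙ} at 0 gives exactly the weighted sum
-- Σ k_ν ∏_{μ≤ν} α_{y_μ}/β_{y_μ}, while a₀^m evaluates to m.  Hence
-- w = a₀^m in F(G) forces the weighted sum to equal m.

open import Defs
open import Data.Bool using (Bool; true; false)
open import Data.Empty using (⊥-elim)
open import Data.Fin using (Fin)
open import Data.List using ([]; _∷_; _++_; replicate)
open import Data.Nat using (zero; suc)
open import Data.Integer as ℤ using (ℤ; +_; -[1+_])
import Data.Integer.Properties as ℤP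
import Data.Integer.Solver as ℤSolver
open import Data.Product using (Σ; _×_; _,_)
open import Data.Sum using (inj₁; inj₂)
open import Data.Rational.Unnormalised as ℚ using (ℚᵘ; _≃_; *≡*; _/_; 0ℚᵘ; 1ℚᵘ)
open import Data.Rational.Unnormalised.Properties
  using (≃-refl; ≃-sym; ≃-trans; +-congˡ; +-congʳ; +-cong; *-congˡ; *-congʳ;
         +-assoc; +-identityˡ; *-assoc; *-comm; *-identityˡ; module ≃-Reasoning)
import Data.Rational.Unnormalised.Solver as ℚSolver
open import Relation.Binary.PropositionalEquality using (_≡_; _≢_; refl; sym; trans; cong; subst)

module ℤS = ℤSolver.+-*-Solver
module ℚS = ℚSolver.+-*-Solver
open ≃-Reasoning

/1-+ : ∀ p q → (p / 1) ℚ.+ (q / 1) ≃ (p ℤ.+ q) / 1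
/1-+ p q = *≡* (solve 2 (λ P Q → (P :* con (+ 1) :+ Q :* con (+ 1)) :* con (+ 1)
                                  := (P :+ Q) :* con (+ 1)) refl p q)
  where open ℤS

module AffineAction (G : GBS) where
  open GBS G

  divℤ-*-denominator : ∀ p q → q ≢ + 0 → divℤ G p q ℚ.* (q / 1) ≃ p / 1
  divℤ-*-denominator p (+ zero)  q≢0 = ⊥-elim (q≢0 refl)
  divℤ-*-denominator p (+ suc n) _   = *≡* (solve 2 (λ P Q → (P :* Q) :* con (+ 1)
                                                      := P :* (Q :* con (+ 1))) refl p (+ suc n))
    where open ℤS
  divℤ-*-denominator p -[1+ n ]  _   = *≡* (solve 2 (λ P Q → ((:- P) :* (:- Q)) :* con (+ 1)
                                                      := P :* (Q :* con (+ 1))) refl p (+ suc n))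
    where open ℤS

  divℤ-*-swap : ∀ p q → p ≢ + 0 → q ≢ + 0 → divℤ G p q ℚ.* divℤ G q p ≃ 1ℚᵘ
  divℤ-*-swap (+ zero)  q         p≢0 _   = ⊥-elim (p≢0 refl)
  divℤ-*-swap p         (+ zero)  _   q≢0 = ⊥-elim (q≢0 refl)
  divℤ-*-swap (+ suc m) (+ suc n) _   _   = *≡* (solve 2 (λ P Q → (P :* Q) :* con (+ 1)
                                                    := con (+ 1) :* (Q :* P)) refl (+ suc m) (+ suc n))
    where open ℤS
  divℤ-*-swap (+ suc m) -[1+ n ]  _   _   = *≡* (solve 2 (λ P Q → ((:- P) :* (:- Q)) :* con (+ 1)
                                                    := con (+ 1) :* (Q :* P)) refl (+ suc m) (+ suc n))
    where open ℤS
  divℤ-*-swap -[1+ m ]  (+ suc n) _   _   = *≡* (solve 2 (λ P Q → ((:- P) :* (:- Q)) :* con (+ 1)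
                                                    := con (+ 1) :* (Q :* P)) refl (+ suc m) (+ suc n))
    where open ℤS
  divℤ-*-swap -[1+ m ]  -[1+ n ]  _   _   = *≡* (solve 2 (λ P Q → ((:- (:- P)) :* (:- (:- Q))) :* con (+ 1)
                                                    := con (+ 1) :* (Q :* P)) refl (+ suc m) (+ suc n))
    where open ℤS

  slope : Fin nE → ℚᵘ
  slope y = divℤ G (α y) (β y)

  slope-bar : ∀ y → slope y ℚ.* slope (bar y) ≃ 1ℚᵘ
  slope-bar y rewrite α-bar (bar y) | bar-inv y | sym (α-bar y) =
    divℤ-*-swap (α y) (β y) (α≢0 y) (β≢0 y)

  dilate-bar : ∀ y x → slope (bar y) ℚ.* (slope y ℚ.* x) ≃ x
  dilate-bar y x = begin
    slope (bar y) ℚ.* (slope y ℚ.* x) ≈⟨ ≃-sym (*-assoc (slope (bar y)) (slope y) x) ⟩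
    slope (bar y) ℚ.* slope y ℚ.* x   ≈⟨ *-congʳ {x} (≃-trans (*-comm (slope (bar y)) (slope y)) (slope-bar y)) ⟩
    1ℚᵘ ℚ.* x                         ≈⟨ *-identityˡ x ⟩
    x                                 ∎

  sign : Bool → ℤ
  sign true  = + 1
  sign false = -[1+ 0 ]

  act : Gen G → Bool → ℚᵘ → ℚᵘ
  act (inj₁ a) b     x = x ℚ.+ sign b / 1
  act (inj₂ y) true  x = slope y ℚ.* x
  act (inj₂ y) false x = slope (bar y) ℚ.* x

  evaluate : Word G → ℚᵘ → ℚᵘ
  evaluate []            x = x
  evaluate ((g , b) ∷ w) x = act g b (evaluate w x)

  evaluate-++ : ∀ u v x → evaluate (u ++ v) x ≡ evaluate u (evaluate v x)
  evaluate-++ []            v x = refl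
  evaluate-++ ((g , b) ∷ u) v x = cong (act g b) (evaluate-++ u v x)

  evaluate-cong : ∀ u {x x′} → x ≃ x′ → evaluate u x ≃ evaluate u x′
  evaluate-cong []                       x≃x′ = x≃x′
  evaluate-cong ((inj₁ a , b)     ∷ u) x≃x′ = +-congˡ (sign b / 1) (evaluate-cong u x≃x′)
  evaluate-cong ((inj₂ y , true)  ∷ u) x≃x′ = *-congˡ {slope y} (evaluate-cong u x≃x′)
  evaluate-cong ((inj₂ y , false) ∷ u) x≃x′ = *-congˡ {slope (bar y)} (evaluate-cong u x≃x′)

  evaluate-replicate : ∀ a b n x →
    evaluate (replicate n (inj₁ a , b)) x ≃ x ℚ.+ (+ n ℤ.* sign b) / 1
  evaluate-replicate a b zero    x = ≃-sym (ℚS.solve 1 (λ X → X ℚS.:+ ℚS.con 0ℚᵘ ℚS.:= X) ≃-refl x)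
  evaluate-replicate a b (suc n) x = begin
    evaluate (replicate n (inj₁ a , b)) x ℚ.+ sign b / 1 ≈⟨ +-congˡ (sign b / 1) (evaluate-replicate a b n x) ⟩
    x ℚ.+ (+ n ℤ.* sign b) / 1 ℚ.+ sign b / 1           ≈⟨ +-assoc x _ _ ⟩
    x ℚ.+ ((+ n ℤ.* sign b) / 1 ℚ.+ sign b / 1)         ≈⟨ +-congʳ x (/1-+ (+ n ℤ.* sign b) (sign b)) ⟩
    x ℚ.+ (+ n ℤ.* sign b ℤ.+ sign b) / 1               ≡⟨ cong (λ k → x ℚ.+ k / 1) (succ-times n (sign b)) ⟩
    x ℚ.+ (+ suc n ℤ.* sign b) / 1                      ∎
    where
    succ-times : ∀ m s → + m ℤ.* s ℤ.+ s ≡ + suc m ℤ.* s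
    succ-times m s = ℤS.solve 2 (λ N S → N ℤS.:* S ℤS.:+ S ℤS.:= (ℤS.con (+ 1) ℤS.:+ N) ℤS.:* S) refl (+ m) s

  evaluate-vpow : ∀ a k x → evaluate (vpow G a k) x ≃ x ℚ.+ k / 1
  evaluate-vpow a (+ n) x = subst (λ k → evaluate (vpow G a (+ n)) x ≃ x ℚ.+ k / 1)
                                  (ℤP.*-identityʳ (+ n)) (evaluate-replicate a true n x)
  evaluate-vpow a -[1+ n ] x = subst (λ k → evaluate (vpow G a -[1+ n ]) x ≃ x ℚ.+ k / 1)
                                     (trans (ℤP.*-comm (+ suc n) -[1+ 0 ]) (ℤP.-1*i≡-i (+ suc n))) (evaluate-replicate a false (suc n) x)

  -- y a^{β_y} ȳ acts as the translation by α_y/β_y · β_y = α_y, like a^{α_y}.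
  evaluate-rel-edge : ∀ y x →
    evaluate (edge G y ++ vpow G (τ y) (β y) ++ edge G (bar y)) x ≃ evaluate (vpow G (ι y) (α y)) x
  evaluate-rel-edge y x = begin
    slope y ℚ.* evaluate (vpow G (τ y) (β y) ++ edge G (bar y)) x
      ≡⟨ cong (slope y ℚ.*_) (evaluate-++ (vpow G (τ y) (β y)) (edge G (bar y)) x) ⟩
    slope y ℚ.* evaluate (vpow G (τ y) (β y)) (slope (bar y) ℚ.* x)
      ≈⟨ *-congˡ {slope y} (evaluate-vpow (τ y) (β y) _) ⟩
    slope y ℚ.* (slope (bar y) ℚ.* x ℚ.+ β y / 1)
      ≈⟨ ℚS.solve 4 (λ S T X B → S ℚS.:* (T ℚS.:* X ℚS.:+ B) ℚS.:= (S ℚS.:* T) ℚS.:* X ℚS.:+ S ℚS.:* B)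
                    ≃-refl (slope y) (slope (bar y)) x (β y / 1) ⟩
    slope y ℚ.* slope (bar y) ℚ.* x ℚ.+ slope y ℚ.* (β y / 1)
      ≈⟨ +-cong (*-congʳ {x} (slope-bar y)) (divℤ-*-denominator (α y) (β y) (β≢0 y)) ⟩
    1ℚᵘ ℚ.* x ℚ.+ α y / 1
      ≈⟨ +-congˡ (α y / 1) (*-identityˡ x) ⟩
    x ℚ.+ α y / 1
      ≈⟨ ≃-sym (evaluate-vpow (ι y) (α y) x) ⟩
    evaluate (vpow G (ι y) (α y)) x ∎

  evaluate-respects : ∀ {u v} → _≈_ G u v → ∀ x → evaluate u x ≃ evaluate v x
  evaluate-respects ≈-refl            x = ≃-refl
  evaluate-respects (≈-sym u≈v)       x = ≃-sym (evaluate-respects u≈v x)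
  evaluate-respects (≈-trans u≈v v≈w) x = ≃-trans (evaluate-respects u≈v x) (evaluate-respects v≈w x)
  evaluate-respects (≈-cong {u} {u′} {v} {v′} u≈u′ v≈v′) x = begin
    evaluate (u ++ v) x         ≡⟨ evaluate-++ u v x ⟩
    evaluate u (evaluate v x)   ≈⟨ evaluate-cong u (evaluate-respects v≈v′ x) ⟩
    evaluate u (evaluate v′ x)  ≈⟨ evaluate-respects u≈u′ (evaluate v′ x) ⟩
    evaluate u′ (evaluate v′ x) ≡⟨ sym (evaluate-++ u′ v′ x) ⟩
    evaluate (u′ ++ v′) x       ∎
  evaluate-respects (cancel (inj₁ a) true)  x =
    ℚS.solve 1 (λ X → (X ℚS.:+ ℚS.:- ℚS.con 1ℚᵘ) ℚS.:+ ℚS.con 1ℚᵘ ℚS.:= X) ≃-refl x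
  evaluate-respects (cancel (inj₁ a) false) x =
    ℚS.solve 1 (λ X → (X ℚS.:+ ℚS.con 1ℚᵘ) ℚS.:+ ℚS.:- ℚS.con 1ℚᵘ ℚS.:= X) ≃-refl x
  evaluate-respects (cancel (inj₂ y) true)  x =
    subst (λ z → slope z ℚ.* (slope (bar y) ℚ.* x) ≃ x) (bar-inv y) (dilate-bar (bar y) x)
  evaluate-respects (cancel (inj₂ y) false) x = dilate-bar y x
  evaluate-respects (rel-bar y)             x = dilate-bar y x
  evaluate-respects (rel-edge y)            x = evaluate-rel-edge y x

  evaluate-stepsWord : ∀ r st → r ℚ.* evaluate (stepsWord G st) 0ℚᵘ ≃ stepsSum G r st
  evaluate-stepsWord r [] = ℚS.solve 1 (λ R → R ℚS.:* ℚS.con 0ℚᵘ ℚS.:= ℚS.con 0ℚᵘ) ≃-refl r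
  evaluate-stepsWord r ((y , k) ∷ st) = begin
    r ℚ.* (slope y ℚ.* evaluate (vpow G (τ y) k ++ stepsWord G st) 0ℚᵘ)
      ≡⟨ cong (λ z → r ℚ.* (slope y ℚ.* z)) (evaluate-++ (vpow G (τ y) k) (stepsWord G st) 0ℚᵘ) ⟩
    r ℚ.* (slope y ℚ.* evaluate (vpow G (τ y) k) tail)
      ≈⟨ *-congˡ {r} (*-congˡ {slope y} (evaluate-vpow (τ y) k tail)) ⟩
    r ℚ.* (slope y ℚ.* (tail ℚ.+ k / 1))
      ≈⟨ ℚS.solve 4 (λ R S X K → R ℚS.:* (S ℚS.:* (X ℚS.:+ K)) ℚS.:= K ℚS.:* (R ℚS.:* S) ℚS.:+ (R ℚS.:* S) ℚS.:* X)
                    ≃-refl r (slope y) tail (k / 1) ⟩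
    (k / 1) ℚ.* (r ℚ.* slope y) ℚ.+ (r ℚ.* slope y) ℚ.* tail
      ≈⟨ +-congʳ ((k / 1) ℚ.* (r ℚ.* slope y)) (evaluate-stepsWord (r ℚ.* slope y) st) ⟩
    stepsSum G r ((y , k) ∷ st) ∎
    where
    tail : ℚᵘ
    tail = evaluate (stepsWord G st) 0ℚᵘ

  evaluate-word : ∀ f → evaluate (word G f) 0ℚᵘ ≃ exponent G f
  evaluate-word f = begin
    evaluate (vpow G a₀ k₀ ++ stepsWord G steps) 0ℚᵘ ≡⟨ evaluate-++ (vpow G a₀ k₀) (stepsWord G steps) 0ℚᵘ ⟩
    evaluate (vpow G a₀ k₀) tail                     ≈⟨ evaluate-vpow a₀ k₀ tail ⟩
    tail ℚ.+ k₀ / 1                                  ≈⟨ ℚS.solve 2 (λ X K → X ℚS.:+ K ℚS.:= K ℚS.:+ ℚS.con 1ℚᵘ ℚS.:* X)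
                                                                   ≃-refl tail (k₀ / 1) ⟩
    k₀ / 1 ℚ.+ 1ℚᵘ ℚ.* tail                          ≈⟨ +-congʳ (k₀ / 1) (evaluate-stepsWord 1ℚᵘ steps) ⟩
    exponent G f                                     ∎
    where
    open Factorization f
    tail : ℚᵘ
    tail = evaluate (stepsWord G steps) 0ℚᵘ

mainTheorem4 : (G : GBS) (f : Factorization G) →
    Σ ℤ (λ m → _≈_ G (word G f) (vpow G (Factorization.a₀ f) m)) →
    Σ ℤ (λ k → (exponent G f ≃ (k / 1)) × _≈_ G (word G f) (vpow G (Factorization.a₀ f) k))
mainTheorem4 G f (m , w≈a₀^m) = m , exponent≃m , w≈a₀^m
  where
  open AffineAction G
  open Factorization f using (a₀)
  exponent≃m : exponent G f ≃ m / 1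
  exponent≃m = begin
    exponent G f               ≈⟨ ≃-sym (evaluate-word f) ⟩
    evaluate (word G f) 0ℚᵘ    ≈⟨ evaluate-respects w≈a₀^m 0ℚᵘ ⟩
    evaluate (vpow G a₀ m) 0ℚᵘ ≈⟨ evaluate-vpow a₀ m 0ℚᵘ ⟩
    0ℚᵘ ℚ.+ m / 1              ≈⟨ +-identityˡ (m / 1) ⟩
    m / 1                      ∎
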